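{- Let $\mathcal{A}\subset\mathbb{O}\setminus\{0\}$ be finite. Given $p,q\in\mathcal{A}+\mathcal{A}$ and distinct $x,y\in\mathcal{A}\mathcal{A}^{ -1}$, there is at most one quadruple $(a,b,c,d)\in\mathcal{A}^4$ such that $$a+c=p,\quad b+d=q,\quad ab^{ -1}=x,\quad cd^{ -1}=y.$$
   Context: $\mathbb{O}$ denotes the octonions. $\mathcal{A}+\mathcal{A}=\{a+b:a,b\in\mathcal{A}\}$ and $\mathcal{A}\mathcal{A}^{ -1}=\{ab^{ -1}:a,b\in\mathcal{A}\}$. -}

module Defs where

open import Level using (Level; _⊔_)
open import Data.Product using (_×_; _,_; ∃-syntax; proj₁; proj₂)
open import Data.List using (List)
open import Data.List.Relation.Unary.Any using (Any)
open import Relation.Nullary using (¬_)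
open import Relation.Binary.Structures using (IsTotalOrder)
open import Algebra.Bundles using (CommutativeRing)

-- An ordered field (the real numbers ℝ are an instance; the standard
-- library has no ℝ, so we work over an arbitrary ordered field).
record OrderedField (c ℓ : Level) : Set (Level.suc (c ⊔ ℓ)) where
  field
    commutativeRing : CommutativeRing c ℓ
  open CommutativeRing commutativeRing public
  infix 4 _≤_
  infix 9 _⁻¹
  field
    _≤_          : Carrier → Carrier → Set ℓ
    isTotalOrder : IsTotalOrder _≈_ _≤_
    +-mono-≤     : ∀ {x y} z → x ≤ y → x + z ≤ y + z
    *-nonneg     : ∀ {x y} → 0# ≤ x → 0# ≤ y → 0# ≤ x * y
    1≉0          : ¬ (1# ≈ 0#)
    _⁻¹          : Carrier → Carrier
    ⁻¹-inverse   : ∀ x → ¬ (x ≈ 0#) → x * x ⁻¹ ≈ 1#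

record StarAlg {c ℓ : Level} (F : OrderedField c ℓ) (a e : Level)
       : Set (Level.suc (a ⊔ e) ⊔ c) where
  field
    Car   : Set a
    _≈_   : Car → Car → Set e
    _+_   : Car → Car → Car
    -_    : Car → Car
    _*_   : Car → Car → Car
    conj  : Car → Car
    zero  : Car
    one   : Car
    norm  : Car → OrderedField.Carrier F     -- sum of squares of coordinates
    scale : OrderedField.Carrier F → Car → Car

base : ∀ {c ℓ} (F : OrderedField c ℓ) → StarAlg F c ℓ
base F = record
  { Car = Carrier ; _≈_ = _≈_ ; _+_ = _+_ ; -_ = -_ ; _*_ = _*_
  ; conj = λ x → x ; zero = 0# ; one = 1# ; norm = λ x → x * x ; scale = _*_ }
  where open OrderedField F

double : ∀ {c ℓ a e} {F : OrderedField c ℓ} → StarAlg F a e → StarAlg F a e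
double {F = F} S = record
  { Car = Car × Car
  ; _≈_ = λ { (a , b) (c , d) → (a ≈ c) × (b ≈ d) }
  ; _+_ = λ { (a , b) (c , d) → (a + c , b + d) }
  ; -_ = λ { (a , b) → (- a , - b) }
  ; _*_ = λ { (a , b) (c , d) → ((a * c) + (- (conj d * b)) , (d * a) + (b * conj c)) }
  ; conj = λ { (a , b) → (conj a , - b) }
  ; zero = (zero , zero)
  ; one = (one , zero)
  ; norm = λ { (a , b) → norm a F.+ norm b }
  ; scale = λ r → λ { (a , b) → (scale r a , scale r b) }
  }
  where
    open StarAlg S
    module F = OrderedField F

Oct : ∀ {c ℓ} (F : OrderedField c ℓ) → StarAlg F c ℓ
Oct F = double (double (double (base F)))

module Octonions {c ℓ} (F : OrderedField c ℓ) where
  open StarAlg (Oct F) public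
  𝕆 : Set c
  𝕆 = Car

  inv : 𝕆 → 𝕆
  inv x = scale (OrderedField._⁻¹ F (norm x)) (conj x)

  _∈_ : 𝕆 → List 𝕆 → Set (c ⊔ ℓ)
  z ∈ A = Any (λ w → z ≈ w) A

  _∈A+A_ : 𝕆 → List 𝕆 → Set (c ⊔ ℓ)
  z ∈A+A A = ∃[ u ] ∃[ v ] (u ∈ A × v ∈ A × z ≈ (u + v))

  _∈AA⁻¹_ : 𝕆 → List 𝕆 → Set (c ⊔ ℓ)
  z ∈AA⁻¹ A = ∃[ u ] ∃[ v ] (u ∈ A × v ∈ A × z ≈ (u * inv v))

-- Since a b⁻¹ = x with b ≠ 0, alternativity of 𝕆 gives a = x b, and likewise c = y d.
-- Hence (x − y) b = x b + y d − y (b + d) = p − y q is the same for every solution, and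
-- since x − y ≠ 0, left multiplication by x − y is injective (again by alternativity,
-- u⁻¹ (u z) = z). So b is determined, and then so are d = q − b, a = x b and c = y d.
module Submission where

open import Level using (Level; 0ℓ; _⊔_)
open import Data.Nat as ℕ using (ℕ; suc)
open import Data.Product using (_×_; _,_)
open import Data.Product.Properties using (≡-dec)
open import Data.Maybe using (just; nothing)
open import Data.Fin using (Fin; #_; combine; _↑ˡ_; _↑ʳ_)
open import Data.Vec using (Vec; []; _∷_; _++_; concat; map)
open import Data.List using (List)
open import Data.List.Relation.Unary.All using (All; lookupₛ)
open import Data.Sum using (inj₁; inj₂)
open import Relation.Nullary using (¬_; yes; no)
open import Relation.Binary.PropositionalEquality as ≡ using (_≡_)
open import Relation.Binary.Definitions using (WeaklyDecidable)
open import Relation.Binary.Structures using (IsEquivalence; IsTotalOrder)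
open import Relation.Binary.Bundles using (Setoid)
open import Algebra.Bundles using (RawRing; CommutativeRing)
import Algebra.Properties.Ring
open import Algebra.Solver.Ring.AlmostCommutativeRing
  using (fromCommutativeRing; _-Raw-AlmostCommutative⟶_; Induced-equivalence)
import Tactic.RingSolver.Core.AlmostCommutativeRing as Tactic
import Tactic.RingSolver.NonReflective as NonReflective
open import Defs

-- Integers as formal differences m − n, kept reduced (one component zero), so that
-- equal coefficients are syntactically equal and the normaliser detects cancellation.
ℕ² : Set
ℕ² = ℕ × ℕ

reduce : ℕ → ℕ → ℕ²
reduce (suc m) (suc n) = reduce m n
reduce m       n       = m , n

ℕ²-rawRing : RawRing 0ℓ 0ℓ
ℕ²-rawRing = record
  { Carrier = ℕ²
  ; _≈_     = _≡_
  ; _+_     = λ { (a , b) (c , d) → reduce (a ℕ.+ c) (b ℕ.+ d) }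
  ; _*_     = λ { (a , b) (c , d) → reduce (a ℕ.* c ℕ.+ b ℕ.* d) (a ℕ.* d ℕ.+ b ℕ.* c) }
  ; -_      = λ { (a , b) → b , a }
  ; 0#      = 0 , 0
  ; 1#      = 1 , 0
  }

module IntegerCoefficients {c ℓ} (R : CommutativeRing c ℓ) where
  open CommutativeRing R
  open import Algebra.Properties.Semiring.Mult semiring
    using (×-homo-+; ×1-homo-*) renaming (_×_ to _·_)
  open import Algebra.Properties.Ring ring
    using (-‿+-comm; ⁻¹-anti-homo‿-; -‿distribˡ-*; -‿distribʳ-*; -0#≈0#; [y-z]x≈yx-zx)
  open import Relation.Binary.Reasoning.Setoid setoid
  -- The stock normaliser used here takes the ring elements themselves as coefficients and
  -- cannot decide when they vanish, so it only proves identities without cancellation.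
  open NonReflective (Tactic.fromCommutativeRing R (λ _ → nothing)) using (solve; _⊜_; _⊕_; _⊗_; ⊝_)

  ⟦_⟧ℤ : ℕ² → Carrier
  ⟦ m , n ⟧ℤ = m · 1# - n · 1#

  x+y-[x+z]≈y-z : ∀ x y z → (x + y) - (x + z) ≈ y - z
  x+y-[x+z]≈y-z x y z = begin
    (x + y) - (x + z)      ≈⟨ +-congˡ (-‿+-comm x z) ⟨
    (x + y) + (- x + - z)  ≈⟨ solve 3 (λ x y z → ((x ⊕ y) ⊕ (⊝ x ⊕ ⊝ z)) ⊜ ((x ⊕ ⊝ x) ⊕ (y ⊕ ⊝ z))) refl x y z ⟩
    (x - x) + (y - z)      ≈⟨ +-congʳ (-‿inverseʳ x) ⟩
    0# + (y - z)           ≈⟨ +-identityˡ _ ⟩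
    y - z                  ∎

  [x+y]-[z+w]≈[x-z]+[y-w] : ∀ x y z w → (x + y) - (z + w) ≈ (x - z) + (y - w)
  [x+y]-[z+w]≈[x-z]+[y-w] = solve 4 (λ x y z w → ((x ⊕ y) ⊕ ⊝ (z ⊕ w)) ⊜ ((x ⊕ ⊝ z) ⊕ (y ⊕ ⊝ w))) refl

  [xz+yw]-[xw+yz]≈[x-y][z-w] : ∀ x y z w → (x * z + y * w) - (x * w + y * z) ≈ (x - y) * (z - w)
  [xz+yw]-[xw+yz]≈[x-y][z-w] x y z w = begin
    (x * z + y * w) - (x * w + y * z)    ≈⟨ rearrange x y z w ⟩
    (x * z - y * z) + (y * w - x * w)    ≈⟨ +-cong ([y-z]x≈yx-zx z x y) ([y-z]x≈yx-zx w y x) ⟨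
    (x - y) * z + (y - x) * w            ≈⟨ +-congˡ (*-congʳ (⁻¹-anti-homo‿- x y)) ⟨
    (x - y) * z + - (x - y) * w          ≈⟨ +-congˡ (-‿distribˡ-* (x - y) w) ⟨
    (x - y) * z + - ((x - y) * w)        ≈⟨ +-congˡ (-‿distribʳ-* (x - y) w) ⟩
    (x - y) * z + (x - y) * - w          ≈⟨ distribˡ (x - y) z (- w) ⟨
    (x - y) * (z - w)                    ∎
    where
    rearrange : ∀ x y z w → (x * z + y * w) - (x * w + y * z) ≈ (x * z - y * z) + (y * w - x * w)
    rearrange = solve 4 (λ x y z w → ((x ⊗ z ⊕ y ⊗ w) ⊕ ⊝ (x ⊗ w ⊕ y ⊗ z))
                                   ⊜ ((x ⊗ z ⊕ ⊝ (y ⊗ z)) ⊕ (y ⊗ w ⊕ ⊝ (x ⊗ w)))) refl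

  ⟦reduce⟧ : ∀ m n → ⟦ reduce m n ⟧ℤ ≈ ⟦ m , n ⟧ℤ
  ⟦reduce⟧ (suc m) (suc n) = trans (⟦reduce⟧ m n) (sym (x+y-[x+z]≈y-z 1# (m · 1#) (n · 1#)))
  ⟦reduce⟧ 0       n       = refl
  ⟦reduce⟧ (suc m) 0       = refl

  ℤ-homomorphism : ℕ²-rawRing -Raw-AlmostCommutative⟶ fromCommutativeRing R
  ℤ-homomorphism = record
    { ⟦_⟧    = ⟦_⟧ℤ
    ; +-homo = λ { (a , b) (c , d) → begin
        ⟦ reduce (a ℕ.+ c) (b ℕ.+ d) ⟧ℤ       ≈⟨ ⟦reduce⟧ (a ℕ.+ c) (b ℕ.+ d) ⟩
        (a ℕ.+ c) · 1# - (b ℕ.+ d) · 1#        ≈⟨ +-cong (×-homo-+ 1# a c) (-‿cong (×-homo-+ 1# b d)) ⟩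
        (a · 1# + c · 1#) - (b · 1# + d · 1#)  ≈⟨ [x+y]-[z+w]≈[x-z]+[y-w] _ _ _ _ ⟩
        ⟦ a , b ⟧ℤ + ⟦ c , d ⟧ℤ                ∎ }
    ; *-homo = λ { (a , b) (c , d) → begin
        ⟦ reduce (a ℕ.* c ℕ.+ b ℕ.* d) (a ℕ.* d ℕ.+ b ℕ.* c) ⟧ℤ
          ≈⟨ ⟦reduce⟧ (a ℕ.* c ℕ.+ b ℕ.* d) (a ℕ.* d ℕ.+ b ℕ.* c) ⟩
        (a ℕ.* c ℕ.+ b ℕ.* d) · 1# - (a ℕ.* d ℕ.+ b ℕ.* c) · 1#
          ≈⟨ +-cong (·-homo a c b d) (-‿cong (·-homo a d b c)) ⟩
        ((a · 1#) * (c · 1#) + (b · 1#) * (d · 1#)) - ((a · 1#) * (d · 1#) + (b · 1#) * (c · 1#))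
          ≈⟨ [xz+yw]-[xw+yz]≈[x-y][z-w] _ _ _ _ ⟩
        ⟦ a , b ⟧ℤ * ⟦ c , d ⟧ℤ
          ∎ }
    ; -‿homo = λ { (a , b) → sym (⁻¹-anti-homo‿- (a · 1#) (b · 1#)) }
    ; 0-homo = -‿inverseʳ 0#
    ; 1-homo = trans (+-cong (+-identityʳ 1#) -0#≈0#) (+-identityʳ 1#)
    }
    where
    ·-homo : ∀ a c b d → (a ℕ.* c ℕ.+ b ℕ.* d) · 1# ≈ (a · 1#) * (c · 1#) + (b · 1#) * (d · 1#)
    ·-homo a c b d = trans (×-homo-+ 1# (a ℕ.* c) (b ℕ.* d)) (+-cong (×1-homo-* a c) (×1-homo-* b d))

  _≟ℤ_ : WeaklyDecidable (Induced-equivalence ℤ-homomorphism)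
  i ≟ℤ j with ≡-dec ℕ._≟_ ℕ._≟_ i j
  ... | yes ≡.refl = just refl
  ... | no _       = nothing

  open import Algebra.Solver.Ring ℕ²-rawRing (fromCommutativeRing R) ℤ-homomorphism _≟ℤ_ public

module OrderedFieldProperties {c ℓ} (F : OrderedField c ℓ) where
  open OrderedField F
  open IsTotalOrder isTotalOrder
    using (total; antisym) renaming (trans to ≤-trans; ≲-respˡ-≈ to ≤-respˡ-≈; ≲-respʳ-≈ to ≤-respʳ-≈)
  open import Algebra.Properties.Ring ring using (-‿distribˡ-*; -‿distribʳ-*; -‿involutive)

  x≤0⇒0≤-x : ∀ {x} → x ≤ 0# → 0# ≤ - x
  x≤0⇒0≤-x {x} x≤0 = ≤-respˡ-≈ (-‿inverseʳ x) (≤-respʳ-≈ (+-identityˡ (- x)) (+-mono-≤ (- x) x≤0))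

  0≤x*x : ∀ x → 0# ≤ x * x
  0≤x*x x with total 0# x
  ... | inj₁ 0≤x = *-nonneg 0≤x 0≤x
  ... | inj₂ x≤0 = ≤-respʳ-≈ -x*-x≈x*x (*-nonneg 0≤-x 0≤-x)
    where
    0≤-x : 0# ≤ - x
    0≤-x = x≤0⇒0≤-x x≤0
    -x*-x≈x*x : - x * - x ≈ x * x
    -x*-x≈x*x = trans (sym (-‿distribˡ-* x (- x))) (trans (-‿cong (sym (-‿distribʳ-* x x))) (-‿involutive (x * x)))

  x≤x+y : ∀ x {y} → 0# ≤ y → x ≤ x + y
  x≤x+y x {y} 0≤y = ≤-respˡ-≈ (+-identityˡ x) (≤-respʳ-≈ (+-comm y x) (+-mono-≤ x 0≤y))

  0≤x+y : ∀ {x y} → 0# ≤ x → 0# ≤ y → 0# ≤ x + y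
  0≤x+y {x} 0≤x 0≤y = ≤-trans 0≤x (x≤x+y x 0≤y)

  x+y≈0⇒x≈0 : ∀ {x y} → 0# ≤ y → x + y ≈ 0# → 0# ≤ x → x ≈ 0#
  x+y≈0⇒x≈0 {x} 0≤y x+y≈0 0≤x = antisym (≤-respʳ-≈ x+y≈0 (x≤x+y x 0≤y)) 0≤x

  x⁻¹*x≈1 : ∀ {x} → ¬ (x ≈ 0#) → x ⁻¹ * x ≈ 1#
  x⁻¹*x≈1 {x} x≉0 = trans (*-comm (x ⁻¹) x) (⁻¹-inverse x x≉0)

  x*x≈0⇒¬¬x≈0 : ∀ {x} → x * x ≈ 0# → ¬ ¬ (x ≈ 0#)
  x*x≈0⇒¬¬x≈0 {x} x*x≈0 x≉0 = 1≉0 (begin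
    1#                        ≈⟨ *-identityˡ 1# ⟨
    1# * 1#                   ≈⟨ *-cong x*x⁻¹≈1 x*x⁻¹≈1 ⟨
    (x * x ⁻¹) * (x * x ⁻¹)   ≈⟨ solve 2 (λ x y → ((x ⊗ y) ⊗ (x ⊗ y)) ⊜ ((x ⊗ x) ⊗ (y ⊗ y))) refl x (x ⁻¹) ⟩
    (x * x) * (x ⁻¹ * x ⁻¹)   ≈⟨ *-congʳ x*x≈0 ⟩
    0# * (x ⁻¹ * x ⁻¹)        ≈⟨ zeroˡ _ ⟩
    0#                        ∎)
    where
    open import Relation.Binary.Reasoning.Setoid setoid
    open NonReflective (Tactic.fromCommutativeRing commutativeRing (λ _ → nothing)) using (solve; _⊜_; _⊗_)
    x*x⁻¹≈1 : x * x ⁻¹ ≈ 1#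
    x*x⁻¹≈1 = ⁻¹-inverse x x≉0

module CayleyDickson {c ℓ} (F : OrderedField c ℓ) where
  private module K = OrderedField F
  open OrderedFieldProperties F

  -- Laws that hold coordinatewise and therefore pass from S to double S; identities
  -- of the product itself are left to the normaliser of OctonionSolver.
  record CoordinateLaws {a e} (S : StarAlg F a e) : Set (c ⊔ ℓ ⊔ a ⊔ e) where
    open StarAlg S
    field
      isEquivalence    : IsEquivalence _≈_
      +-cong           : ∀ {x x′ y y′} → x ≈ x′ → y ≈ y′ → (x + y) ≈ (x′ + y′)
      -‿cong           : ∀ {x x′} → x ≈ x′ → (- x) ≈ (- x′)
      *-cong           : ∀ {x x′ y y′} → x ≈ x′ → y ≈ y′ → (x * y) ≈ (x′ * y′)
      conj-cong        : ∀ {x x′} → x ≈ x′ → conj x ≈ conj x′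
      +-cancelˡ        : ∀ {x y z} → (x + y) ≈ (x + z) → y ≈ z
      x-y≈0⇒x≈y        : ∀ {x y} → (x + (- y)) ≈ zero → x ≈ y
      scale-identity   : ∀ {r} x → r K.≈ K.1# → scale r x ≈ x
      0≤norm           : ∀ x → K.0# K.≤ norm x
      norm≈0⇒¬¬x≈0     : ∀ {x} → norm x K.≈ K.0# → ¬ ¬ (x ≈ zero)
    open IsEquivalence isEquivalence public

    setoid : Setoid a e
    setoid = record { isEquivalence = isEquivalence }

  base-laws : CoordinateLaws (base F)
  base-laws = record
    { isEquivalence  = K.isEquivalence
    ; +-cong         = K.+-cong
    ; -‿cong         = K.-‿cong
    ; *-cong         = K.*-cong
    ; conj-cong      = λ x≈x′ → x≈x′
    ; +-cancelˡ      = Ring.+-cancelˡ _ _ _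
    ; x-y≈0⇒x≈y      = Ring.x∙y⁻¹≈ε⇒x≈y _ _
    ; scale-identity = λ x r≈1 → K.trans (K.*-congʳ r≈1) (K.*-identityˡ x)
    ; 0≤norm         = 0≤x*x
    ; norm≈0⇒¬¬x≈0   = x*x≈0⇒¬¬x≈0
    }
    where module Ring = Algebra.Properties.Ring K.ring

  double-laws : ∀ {a e} {S : StarAlg F a e} → CoordinateLaws S → CoordinateLaws (double S)
  double-laws L = record
    { isEquivalence  = record
      { refl  = L.refl , L.refl
      ; sym   = λ (x≈y , x≈y′) → L.sym x≈y , L.sym x≈y′
      ; trans = λ (x≈y , x≈y′) (y≈z , y≈z′) → L.trans x≈y y≈z , L.trans x≈y′ y≈z′
      }
    ; +-cong         = λ (p , p′) (q , q′) → L.+-cong p q , L.+-cong p′ q′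
    ; -‿cong         = λ (p , p′) → L.-‿cong p , L.-‿cong p′
    ; *-cong         = λ (p , p′) (q , q′) →
        L.+-cong (L.*-cong p q) (L.-‿cong (L.*-cong (L.conj-cong q′) p′)) ,
        L.+-cong (L.*-cong q′ p) (L.*-cong p′ (L.conj-cong q))
    ; conj-cong      = λ (p , p′) → L.conj-cong p , L.-‿cong p′
    ; +-cancelˡ      = λ (p , p′) → L.+-cancelˡ p , L.+-cancelˡ p′
    ; x-y≈0⇒x≈y      = λ (p , p′) → L.x-y≈0⇒x≈y p , L.x-y≈0⇒x≈y p′
    ; scale-identity = λ (x , x′) r≈1 → L.scale-identity x r≈1 , L.scale-identity x′ r≈1
    ; 0≤norm         = λ (x , x′) → 0≤x+y (L.0≤norm x) (L.0≤norm x′)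
    ; norm≈0⇒¬¬x≈0   = λ {(x , x′)} N+N′≈0 x≉0 →
        let N≈0  = x+y≈0⇒x≈0 (L.0≤norm x′) N+N′≈0 (L.0≤norm x)
            N′≈0 = x+y≈0⇒x≈0 (L.0≤norm x) (K.trans (K.+-comm _ _) N+N′≈0) (L.0≤norm x′)
        in L.norm≈0⇒¬¬x≈0 N≈0 (λ x≈0 → L.norm≈0⇒¬¬x≈0 N′≈0 (λ x′≈0 → x≉0 (x≈0 , x′≈0)))
    }
    where module L = CoordinateLaws L

  octonion-laws : CoordinateLaws (Oct F)
  octonion-laws = double-laws (double-laws (double-laws base-laws))

pattern ⟨_,_,_,_,_,_,_,_⟩ x₀ x₁ x₂ x₃ x₄ x₅ x₆ x₇ = ((x₀ , x₁) , (x₂ , x₃)) , ((x₄ , x₅) , (x₆ , x₇))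

Octuple : ∀ {a} → Set a → Set a
Octuple A = ((A × A) × (A × A)) × ((A × A) × (A × A))

mapₒ : ∀ {a b} {A : Set a} {B : Set b} → (A → B) → Octuple A → Octuple B
mapₒ f ⟨ x₀ , x₁ , x₂ , x₃ , x₄ , x₅ , x₆ , x₇ ⟩ = ⟨ f x₀ , f x₁ , f x₂ , f x₃ , f x₄ , f x₅ , f x₆ , f x₇ ⟩

module OctonionSolver {c ℓ} (F : OrderedField c ℓ) where
  private module K = OrderedField F
  open IntegerCoefficients K.commutativeRing public
  open Octonions F
  open CayleyDickson.CoordinateLaws (CayleyDickson.octonion-laws F) using (reflexive; trans; sym)

  -- Evaluation ⟦_⟧ₒ then commutes definitionally with
  -- the octonion operations, so solveₒ proves identities stated directly in 𝕆.
  polynomialAlgebra : ℕ → StarAlg F 0ℓ 0ℓ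
  polynomialAlgebra n = record
    { Car   = Polynomial n
    ; _≈_   = _≡_
    ; _+_   = _:+_
    ; -_    = :-_
    ; _*_   = _:*_
    ; conj  = λ e → e
    ; zero  = con (0 , 0)
    ; one   = con (1 , 0)
    ; norm  = λ _ → K.0#
    ; scale = λ _ e → e
    }

  open module OctExpr {n : ℕ} = StarAlg (double (double (double (polynomialAlgebra n))))
    public using () renaming (_+_ to _+ₑ_; -_ to -ₑ_; _*_ to _*ₑ_; conj to conjₑ)

  normₑ : ∀ {n} → Octuple (Polynomial n) → Polynomial n
  normₑ ⟨ e₀ , e₁ , e₂ , e₃ , e₄ , e₅ , e₆ , e₇ ⟩ =
    (((e₀ :* e₀) :+ (e₁ :* e₁)) :+ ((e₂ :* e₂) :+ (e₃ :* e₃))) :+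
    (((e₄ :* e₄) :+ (e₅ :* e₅)) :+ ((e₆ :* e₆) :+ (e₇ :* e₇)))

  scaleₑ : ∀ {n} → Polynomial n → Octuple (Polynomial n) → Octuple (Polynomial n)
  scaleₑ r = mapₒ (r :*_)

  ⟦_⟧ₒ : ∀ {n} → Octuple (Polynomial n) → Env n → 𝕆
  ⟦ e ⟧ₒ ρ = mapₒ (λ p → ⟦ p ⟧ ρ) e

  ⟦_⟧ₒ↓ : ∀ {n} → Octuple (Polynomial n) → Env n → 𝕆
  ⟦ e ⟧ₒ↓ ρ = mapₒ (λ p → ⟦ p ⟧↓ ρ) e

  correctₒ : ∀ {n} (e : Octuple (Polynomial n)) ρ → ⟦ e ⟧ₒ↓ ρ ≈ ⟦ e ⟧ₒ ρ
  correctₒ ⟨ e₀ , e₁ , e₂ , e₃ , e₄ , e₅ , e₆ , e₇ ⟩ ρ =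
    ⟨ correct e₀ ρ , correct e₁ ρ , correct e₂ ρ , correct e₃ ρ ,
      correct e₄ ρ , correct e₅ ρ , correct e₆ ρ , correct e₇ ρ ⟩

  solveₒ : ∀ {n} (e f : Octuple (Polynomial n)) → mapₒ normalise e ≡ mapₒ normalise f →
           ∀ ρ → ⟦ e ⟧ₒ ρ ≈ ⟦ f ⟧ₒ ρ
  solveₒ e f e↓≡f↓ ρ =
    trans (sym (correctₒ e ρ))
      (trans (reflexive (≡.cong (λ n → mapₒ (λ p → ⟦ p ⟧N ρ) n) e↓≡f↓)) (correctₒ f ρ))

  coordinates : 𝕆 → Vec K.Carrier 8
  coordinates ⟨ x₀ , x₁ , x₂ , x₃ , x₄ , x₅ , x₆ , x₇ ⟩ = x₀ ∷ x₁ ∷ x₂ ∷ x₃ ∷ x₄ ∷ x₅ ∷ x₆ ∷ x₇ ∷ []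

  -- Octonion variable i occupies the positions 8i, …, 8i + 7; the k scalar variables come last.
  octEnv : ∀ {m k} → Vec 𝕆 m → Vec K.Carrier k → Env (m ℕ.* 8 ℕ.+ k)
  octEnv xs rs = concat (map coordinates xs) ++ rs

  octVar : ∀ {m k} → Fin m → Octuple (Polynomial (m ℕ.* 8 ℕ.+ k))
  octVar {k = k} i = ⟨ v (# 0) , v (# 1) , v (# 2) , v (# 3) , v (# 4) , v (# 5) , v (# 6) , v (# 7) ⟩
    where
    v : Fin 8 → Polynomial _
    v j = var (combine i j ↑ˡ k)

  scalarVar : ∀ {m k} → Fin k → Polynomial (m ℕ.* 8 ℕ.+ k)
  scalarVar {m} j = var (m ℕ.* 8 ↑ʳ j)

module OctonionProperties {c ℓ} (F : OrderedField c ℓ) where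
  private module K = OrderedField F
  open Octonions F
  open OctonionSolver F
  open OrderedFieldProperties F using (x⁻¹*x≈1)
  open CayleyDickson.CoordinateLaws (CayleyDickson.octonion-laws F) public

  -- Alternativity, in the forms (a b̄) b = N(b) a and b̄ (b z) = N(b) z: all the argument
  -- needs beyond bilinearity of the product, and what fails for the sedenions.
  right-alternative-conj : ∀ r a b → ((a * scale r (conj b)) * b) ≈ scale (r K.* norm b) a
  right-alternative-conj r a b =
    solveₒ ((A *ₑ scaleₑ R (conjₑ B)) *ₑ B) (scaleₑ (R :* normₑ B) A) ≡.refl (octEnv (a ∷ b ∷ []) (r ∷ []))
    where
    A B : Octuple (Polynomial 17)
    A = octVar {2} {1} (# 0)
    B = octVar {2} {1} (# 1)
    R : Polynomial 17
    R = scalarVar {2} (# 0)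

  left-alternative-conj : ∀ r b z → (scale r (conj b) * (b * z)) ≈ scale (r K.* norm b) z
  left-alternative-conj r b z =
    solveₒ (scaleₑ R (conjₑ B) *ₑ (B *ₑ Z)) (scaleₑ (R :* normₑ B) Z) ≡.refl (octEnv (b ∷ z ∷ []) (r ∷ []))
    where
    B Z : Octuple (Polynomial 17)
    B = octVar {2} {1} (# 0)
    Z = octVar {2} {1} (# 1)
    R : Polynomial 17
    R = scalarVar {2} (# 0)

  [x-y]*b≈[x*b+y*d]-y*[b+d] : ∀ x y b d → ((x + (- y)) * b) ≈ (((x * b) + (y * d)) + (- (y * (b + d))))
  [x-y]*b≈[x*b+y*d]-y*[b+d] x y b d =
    solveₒ ((X +ₑ (-ₑ Y)) *ₑ B) (((X *ₑ B) +ₑ (Y *ₑ D)) +ₑ (-ₑ (Y *ₑ (B +ₑ D)))) ≡.refl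
      (octEnv (x ∷ y ∷ b ∷ d ∷ []) [])
    where
    X Y B D : Octuple (Polynomial 32)
    X = octVar {4} {0} (# 0)
    Y = octVar {4} {0} (# 1)
    B = octVar {4} {0} (# 2)
    D = octVar {4} {0} (# 3)

  x≉0⇒norm≉0 : ∀ {x} → ¬ (x ≈ zero) → ¬ (norm x K.≈ K.0#)
  x≉0⇒norm≉0 x≉0 N≈0 = norm≈0⇒¬¬x≈0 N≈0 x≉0

  *-inv-cancelʳ : ∀ a {b} → ¬ (norm b K.≈ K.0#) → ((a * inv b) * b) ≈ a
  *-inv-cancelʳ a {b} N≉0 = trans (right-alternative-conj (norm b K.⁻¹) a b) (scale-identity a (x⁻¹*x≈1 N≉0))

  inv-*-cancelˡ : ∀ {u} z → ¬ (norm u K.≈ K.0#) → (inv u * (u * z)) ≈ z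
  inv-*-cancelˡ {u} z N≉0 = trans (left-alternative-conj (norm u K.⁻¹) u z) (scale-identity z (x⁻¹*x≈1 N≉0))

  *-cancelˡ : ∀ {u z z′} → ¬ (norm u K.≈ K.0#) → (u * z) ≈ (u * z′) → z ≈ z′
  *-cancelˡ {u} {z} {z′} N≉0 uz≈uz′ =
    trans (sym (inv-*-cancelˡ z N≉0)) (trans (*-cong refl uz≈uz′) (inv-*-cancelˡ z′ N≉0))

  a*b⁻¹≈x⇒x*b≈a : ∀ {a b x} → ¬ (norm b K.≈ K.0#) → (a * inv b) ≈ x → (x * b) ≈ a
  a*b⁻¹≈x⇒x*b≈a {a} N≉0 ab⁻¹≈x = trans (*-cong (sym ab⁻¹≈x) refl) (*-inv-cancelʳ a N≉0)

  [x-y]*b≈p-y*q : ∀ {x y a b c d p q} → (x * b) ≈ a → (y * d) ≈ c → (a + c) ≈ p → (b + d) ≈ q →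
                  ((x + (- y)) * b) ≈ (p + (- (y * q)))
  [x-y]*b≈p-y*q {x} {y} {b = b} {d = d} xb≈a yd≈c a+c≈p b+d≈q =
    trans ([x-y]*b≈[x*b+y*d]-y*[b+d] x y b d)
          (+-cong (trans (+-cong xb≈a yd≈c) a+c≈p) (-‿cong (*-cong refl b+d≈q)))

  quadruple-unique : ∀ {p q x y a b c d a′ b′ c′ d′} → ¬ (x ≈ y) →
    ¬ (norm b K.≈ K.0#) → ¬ (norm d K.≈ K.0#) → ¬ (norm b′ K.≈ K.0#) → ¬ (norm d′ K.≈ K.0#) →
    (a + c) ≈ p → (b + d) ≈ q → (a * inv b) ≈ x → (c * inv d) ≈ y →
    (a′ + c′) ≈ p → (b′ + d′) ≈ q → (a′ * inv b′) ≈ x → (c′ * inv d′) ≈ y →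
    (a ≈ a′) × (b ≈ b′) × (c ≈ c′) × (d ≈ d′)
  quadruple-unique {p} {q} {x} {y} {a} {b} {c} {d} {a′} {b′} {c′} {d′} x≉y Nb≉0 Nd≉0 Nb′≉0 Nd′≉0
                   a+c≈p b+d≈q ab⁻¹≈x cd⁻¹≈y a′+c′≈p b′+d′≈q a′b′⁻¹≈x c′d′⁻¹≈y =
    a≈a′ , b≈b′ , c≈c′ , d≈d′
    where
    xb≈a : (x * b) ≈ a
    xb≈a = a*b⁻¹≈x⇒x*b≈a Nb≉0 ab⁻¹≈x
    yd≈c : (y * d) ≈ c
    yd≈c = a*b⁻¹≈x⇒x*b≈a Nd≉0 cd⁻¹≈y
    xb′≈a′ : (x * b′) ≈ a′
    xb′≈a′ = a*b⁻¹≈x⇒x*b≈a Nb′≉0 a′b′⁻¹≈x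
    yd′≈c′ : (y * d′) ≈ c′
    yd′≈c′ = a*b⁻¹≈x⇒x*b≈a Nd′≉0 c′d′⁻¹≈y
    b≈b′ : b ≈ b′
    b≈b′ = *-cancelˡ (x≉0⇒norm≉0 (λ x-y≈0 → x≉y (x-y≈0⇒x≈y x-y≈0)))
             (trans ([x-y]*b≈p-y*q xb≈a yd≈c a+c≈p b+d≈q) (sym ([x-y]*b≈p-y*q xb′≈a′ yd′≈c′ a′+c′≈p b′+d′≈q)))
    d≈d′ : d ≈ d′
    d≈d′ = +-cancelˡ (trans b+d≈q (trans (sym b′+d′≈q) (+-cong (sym b≈b′) refl)))
    a≈a′ : a ≈ a′
    a≈a′ = trans (sym xb≈a) (trans (*-cong refl b≈b′) xb′≈a′)
    c≈c′ : c ≈ c′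
    c≈c′ = trans (sym yd≈c) (trans (*-cong refl d≈d′) yd′≈c′)

lemma3 : ∀ {c ℓ : Level} (F : OrderedField c ℓ) → let open Octonions F in
    (A : List 𝕆) → All (λ a → ¬ (a ≈ zero)) A →
    (p q x y : 𝕆) → p ∈A+A A → q ∈A+A A → x ∈AA⁻¹ A → y ∈AA⁻¹ A → ¬ (x ≈ y) →
    (a b c d a′ b′ c′ d′ : 𝕆) →
    a ∈ A → b ∈ A → c ∈ A → d ∈ A →
    (a + c) ≈ p → (b + d) ≈ q → (a * inv b) ≈ x → (c * inv d) ≈ y →
    a′ ∈ A → b′ ∈ A → c′ ∈ A → d′ ∈ A →
    (a′ + c′) ≈ p → (b′ + d′) ≈ q → (a′ * inv b′) ≈ x → (c′ * inv d′) ≈ y →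
    (a ≈ a′) × (b ≈ b′) × (c ≈ c′) × (d ≈ d′)
lemma3 F A A≉0 p q x y _ _ _ _ x≉y a b c d a′ b′ c′ d′ _ b∈A _ d∈A a+c≈p b+d≈q ab⁻¹≈x cd⁻¹≈y
       _ b′∈A _ d′∈A a′+c′≈p b′+d′≈q a′b′⁻¹≈x c′d′⁻¹≈y =
  quadruple-unique x≉y (norm≉0 b∈A) (norm≉0 d∈A) (norm≉0 b′∈A) (norm≉0 d′∈A)
    a+c≈p b+d≈q ab⁻¹≈x cd⁻¹≈y a′+c′≈p b′+d′≈q a′b′⁻¹≈x c′d′⁻¹≈y
  where
  open Octonions F
  open OctonionProperties F
  open OrderedField F using (0#) renaming (_≈_ to _≈ₖ_)

  norm≉0 : ∀ {z} → z ∈ A → ¬ (norm z ≈ₖ 0#)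
  norm≉0 z∈A = x≉0⇒norm≉0 (lookupₛ setoid (λ y≈z y≉0 z≈0 → y≉0 (trans y≈z z≈0)) A≉0 z∈A)
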